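{- Let $p\ge 3$ be a prime, let $r=\lfloor\sqrt{p}\rfloor$ and $s=\lfloor\frac{p-2}{r}\rfloor$, and let $t$ be an integer with $0\le t\le p-r$. Then in $\mathbb{F}_p^2$, the union of the main diagonal $\{(x,x):x\in\mathbb{F}_p\}$ and the grid $[t,t+r-1]\times\{0,r,2r,\ldots,sr,p-1\}$ is a $1$-blocking set.
   Context: $\mathbb{F}_p$ is identified with the set of integers $\{0,1,\ldots,p-1\}$; for integers $m\le n$, $[m,n]=\{m,m+1,\ldots,n\}$. A $1$-blocking set in $\mathbb{F}_p^2$ is a set of points that meets every affine line $\{\mathbf{a}+\lambda\mathbf{v}:\lambda\in\mathbb{F}_p\}$ ($\mathbf{v}\ne\mathbf{0}$) of $\mathbb{F}_p^2$ in at least one point. -}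

module Defs where

open import Data.Nat using (ℕ; zero; suc; _+_; _*_; _∸_; _≤_; _<_; NonZero)
open import Data.Nat.DivMod using (_%_)
open import Data.Product using (_×_; _,_; ∃-syntax)
open import Data.Sum using (_⊎_)
open import Relation.Binary.PropositionalEquality using (_≡_)
open import Relation.Nullary using (¬_)

-- Points of F_p^2 are pairs (x , y) of naturals with x , y < p
-- (F_p identified with {0,…,p-1}); arithmetic is reduced mod p.
Point : Set
Point = ℕ × ℕ

linePt : (p : ℕ) → .{{NonZero p}} → ℕ → ℕ → ℕ → ℕ → ℕ → Point
linePt p a₁ a₂ v₁ v₂ l = ((a₁ + l * v₁) % p , (a₂ + l * v₂) % p)

IsBlocking : (p : ℕ) → .{{NonZero p}} → (Point → Set) → Set
IsBlocking p S =
  ∀ a₁ a₂ v₁ v₂ → a₁ < p → a₂ < p → v₁ < p → v₂ < p →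
  ¬ (v₁ ≡ 0 × v₂ ≡ 0) →
  ∃[ l ] (l < p × S (linePt p a₁ a₂ v₁ v₂ l))

DiagGrid : (p r s t : ℕ) → Point → Set
DiagGrid p r s t (x , y) =
  x ≡ y
  ⊎ ((t ≤ x × x ≤ t + r ∸ 1)
     × ((∃[ k ] (k ≤ s × y ≡ k * r)) ⊎ y ≡ p ∸ 1))

-- A line {a + λ v} with v₁ ≠ v₂ meets the diagonal, since λ (v₁ − v₂) ≡ a₂ − a₁ is
-- solvable in F_p. The remaining lines are y − x ≡ c, so it suffices that the differences
-- y − x over the grid cover F_p. With T = t + r and u = k r + j (0 ≤ j < r), the column
-- t + r − 1 − j and row k r give y − x ≡ u + 1 − T, for every u ≤ p − 2 by the choice of s;
-- the corner (t + r − 1, p − 1) gives −T.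

module Submission where

open import Defs
open import Data.Nat using (ℕ; zero; suc; pred; _+_; _*_; _∸_; _≤_; _<_; z≤n; s≤s; s≤s⁻¹; NonZero; >-nonZero⁻¹)
open import Data.Nat.Primality using (Prime; prime⇒nonZero)
open import Data.Nat.Properties
open import Data.Nat.DivMod
open import Data.Nat.Coprimality using (prime⇒coprime; coprime-Bézout)
open import Data.Nat.GCD using (module Bézout)
open import Data.Nat.Tactic.RingSolver using (solve-∀)
open import Algebra.Properties.CommutativeSemigroup +-commutativeSemigroup
  using (x∙yz≈y∙xz; xy∙z≈xz∙y)
open import Data.Product using (_×_; _,_; ∃-syntax)
open import Data.Sum using (_⊎_; inj₁; inj₂)
open import Relation.Binary.Bundles using (Setoid)
open import Relation.Binary.Structures using (IsEquivalence)
open import Relation.Binary.PropositionalEquality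
open import Relation.Binary.Definitions using (tri<; tri≈; tri>)
open import Relation.Nullary using (yes; no; contradiction)

module Modular (n : ℕ) .{{_ : NonZero n}} where

  infix 4 _≈_
  record _≈_ (x y : ℕ) : Set where
    constructor mod-eq
    field %-eq : x % n ≡ y % n
  open _≈_ public

  ≈-reflexive : ∀ {x y} → x ≡ y → x ≈ y
  ≈-reflexive refl = mod-eq refl

  ≈-isEquivalence : IsEquivalence _≈_
  ≈-isEquivalence = record
    { refl  = mod-eq refl
    ; sym   = λ (mod-eq e) → mod-eq (sym e)
    ; trans = λ (mod-eq e) (mod-eq f) → mod-eq (trans e f)
    }

  open IsEquivalence ≈-isEquivalence public
    using () renaming (refl to ≈-refl; trans to ≈-trans)

  ≈-setoid : Setoid _ _
  ≈-setoid = record { isEquivalence = ≈-isEquivalence }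

  +-cong : ∀ {a b c d} → a ≈ b → c ≈ d → a + c ≈ b + d
  +-cong {a} {b} {c} {d} (mod-eq e) (mod-eq f) = mod-eq (begin
    (a + c) % n             ≡⟨ %-distribˡ-+ a c n ⟩
    (a % n + c % n) % n     ≡⟨ cong₂ (λ u v → (u + v) % n) e f ⟩
    (b % n + d % n) % n     ≡⟨ %-distribˡ-+ b d n ⟨
    (b + d) % n             ∎)
    where open ≡-Reasoning

  *-cong : ∀ {a b c d} → a ≈ b → c ≈ d → a * c ≈ b * d
  *-cong {a} {b} {c} {d} (mod-eq e) (mod-eq f) = mod-eq (begin
    (a * c) % n             ≡⟨ %-distribˡ-* a c n ⟩
    (a % n * (c % n)) % n   ≡⟨ cong₂ (λ u v → (u * v) % n) e f ⟩
    (b % n * (d % n)) % n   ≡⟨ %-distribˡ-* b d n ⟨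
    (b * d) % n             ∎)
    where open ≡-Reasoning

  +-congˡ : ∀ a {b c} → b ≈ c → a + b ≈ a + c
  +-congˡ a = +-cong ≈-refl

  +-congʳ : ∀ {a b} c → a ≈ b → a + c ≈ b + c
  +-congʳ c e = +-cong e ≈-refl

  m%n≈m : ∀ m → m % n ≈ m
  m%n≈m m = mod-eq (m%n%n≡m%n m n)

  m+n≈m : ∀ m → m + n ≈ m
  m+n≈m m = mod-eq ([m+n]%n≡m%n m n)

  m+kn≈m : ∀ m k → m + k * n ≈ m
  m+kn≈m m k = mod-eq ([m+kn]%n≡m%n m k n)

  kn≈0 : ∀ k → k * n ≈ 0
  kn≈0 k = m+kn≈m 0 k

  ≈⇒%≡ : ∀ {x y} → x ≈ y → y < n → x % n ≡ y
  ≈⇒%≡ (mod-eq e) y<n = trans e (m<n⇒m%n≡m y<n)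

  open import Relation.Binary.Reasoning.Setoid ≈-setoid

  +-cancelʳ-≈ : ∀ {x y} z → x + z ≈ y + z → x ≈ y
  +-cancelʳ-≈ {x} {y} z e = begin
    x                       ≈⟨ m+kn≈m x z ⟨
    x + z * n               ≡⟨ split x ⟩
    x + z + z * pred n      ≈⟨ +-congʳ (z * pred n) e ⟩
    y + z + z * pred n      ≡⟨ split y ⟨
    y + z * n               ≈⟨ m+kn≈m y z ⟩
    y                       ∎
    where
    split : ∀ m → m + z * n ≡ m + z + z * pred n
    split m = trans (cong (λ k → m + z * k) (sym (suc-pred n)))
                    (trans (cong (m +_) (*-suc z (pred n))) (sym (+-assoc m z (z * pred n))))

  +-solvable : ∀ a c → ∃[ b ] a + b ≈ c
  +-solvable a c = c + (n ∸ a % n) , (begin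
    a + (c + (n ∸ a % n))         ≈⟨ +-congʳ (c + (n ∸ a % n)) (m%n≈m a) ⟨
    a % n + (c + (n ∸ a % n))     ≡⟨ x∙yz≈y∙xz (a % n) c (n ∸ a % n) ⟩
    c + (a % n + (n ∸ a % n))     ≡⟨ cong (c +_) (m+[n∸m]≡n (m%n≤n a n)) ⟩
    c + n                         ≈⟨ m+n≈m c ⟩
    c                             ∎)

  -- m is −1, and (−1)·(−1) = 1.
  1+m≈0⇒pred[n]*m≈1 : ∀ {m} → 1 + m ≈ 0 → pred n * m ≈ 1
  1+m≈0⇒pred[n]*m≈1 {m} e = +-cancelʳ-≈ (pred n) (begin
    pred n * m + pred n       ≡⟨ distrib (pred n) m ⟩
    pred n * (1 + m)          ≈⟨ *-cong (≈-refl {pred n}) e ⟩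
    pred n * 0                ≡⟨ *-zeroʳ (pred n) ⟩
    0                         ≈⟨ kn≈0 1 ⟨
    1 * n                     ≡⟨ trans (*-identityˡ n) (sym (suc-pred n)) ⟩
    1 + pred n                ∎)
    where
    distrib : ∀ k m → k * m + k ≡ k * (1 + m)
    distrib = solve-∀

module PrimeField (p : ℕ) (prime : Prime p) where

  private instance
    p≢0 : NonZero p
    p≢0 = prime⇒nonZero prime

  open Modular p
  open import Relation.Binary.Reasoning.Setoid ≈-setoid

  *-inverse : ∀ {d} → 0 < d → d < p → ∃[ w ] w * d ≈ 1
  *-inverse {suc d} _ d<p with coprime-Bézout (prime⇒coprime prime d<p)
  ... | Bézout.-+ x w eq = w , (begin
    w * suc d     ≡⟨ eq ⟨
    1 + x * p     ≈⟨ m+kn≈m 1 x ⟩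
    1             ∎)
  ... | Bézout.+- x y eq = pred p * y , (begin
    pred p * y * suc d     ≡⟨ *-assoc (pred p) y (suc d) ⟩
    pred p * (y * suc d)   ≈⟨ 1+m≈0⇒pred[n]*m≈1 (≈-trans (≈-reflexive eq) (kn≈0 x)) ⟩
    1                      ∎)

  *-solvable : ∀ {d} → 0 < d → d < p → ∀ c → ∃[ l ] (l < p × l * d ≈ c)
  *-solvable {d} 0<d d<p c with *-inverse 0<d d<p
  ... | w , wd≈1 = (w * c) % p , m%n<n (w * c) p , (begin
    (w * c) % p * d     ≈⟨ *-cong (m%n≈m (w * c)) (≈-refl {d}) ⟩
    w * c * d           ≡⟨ swap w c d ⟩
    w * d * c           ≈⟨ *-cong wd≈1 (≈-refl {c}) ⟩
    1 * c               ≡⟨ *-identityˡ c ⟩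
    c                   ∎)
    where
    swap : ∀ a b c → a * b * c ≡ a * c * b
    swap = solve-∀

  affine-solvable : ∀ {d} → 0 < d → d < p → ∀ a b → ∃[ l ] (l < p × a + l * d ≈ b)
  affine-solvable 0<d d<p a b with +-solvable a b
  ... | c , a+c≈b with *-solvable 0<d d<p c
  ...   | l , l<p , ld≈c = l , l<p , ≈-trans (+-congˡ a ld≈c) a+c≈b

  distinct-slopes-meet : ∀ {u v} → v < u → u < p → ∀ a b →
                         ∃[ l ] (l < p × a + l * u ≈ b + l * v)
  distinct-slopes-meet {u} {v} v<u u<p a b
    with affine-solvable (m<n⇒0<n∸m v<u) (≤-<-trans (m∸n≤m u v) u<p) a b
  ... | l , l<p , e = l , l<p , (begin
    a + l * u                   ≡⟨ cong (λ w → a + l * w) (m∸n+n≡m (<⇒≤ v<u)) ⟨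
    a + l * (u ∸ v + v)         ≡⟨ distrib a l (u ∸ v) v ⟩
    a + l * (u ∸ v) + l * v     ≈⟨ +-congʳ (l * v) e ⟩
    b + l * v                   ∎)
    where
    distrib : ∀ a l d v → a + l * (d + v) ≡ a + l * d + l * v
    distrib = solve-∀

  line-meets-diagonal : ∀ {v₁ v₂} → v₁ ≢ v₂ → v₁ < p → v₂ < p → ∀ a₁ a₂ →
                        ∃[ l ] (l < p × (a₁ + l * v₁) % p ≡ (a₂ + l * v₂) % p)
  line-meets-diagonal v₁≢v₂ v₁<p v₂<p a₁ a₂ with <-cmp _ _
  ... | tri< v₁<v₂ _ _ =
    let l , l<p , e = distinct-slopes-meet v₁<v₂ v₂<p a₂ a₁ in l , l<p , sym (%-eq e)
  ... | tri≈ _ v₁≡v₂ _ = contradiction v₁≡v₂ v₁≢v₂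
  ... | tri> _ _ v₂<v₁ =
    let l , l<p , e = distinct-slopes-meet v₂<v₁ v₁<p a₁ a₂ in l , l<p , %-eq e

  slope-one-line-through : ∀ {v} → 0 < v → v < p → ∀ {a₁ a₂ b x y} →
                           a₁ + b ≈ a₂ → x + b ≈ y → x < p → y < p →
                           ∃[ l ] (l < p × linePt p a₁ a₂ v v l ≡ (x , y))
  slope-one-line-through {v} 0<v v<p {a₁} {a₂} {b} {x} {y} a₁+b≈a₂ x+b≈y x<p y<p
    with affine-solvable 0<v v<p a₁ x
  ... | l , l<p , a₁+lv≈x = l , l<p , cong₂ _,_ (≈⇒%≡ a₁+lv≈x x<p) (≈⇒%≡ a₂+lv≈y y<p)
    where
    a₂+lv≈y : a₂ + l * v ≈ y
    a₂+lv≈y = begin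
      a₂ + l * v          ≈⟨ +-congʳ (l * v) a₁+b≈a₂ ⟨
      a₁ + b + l * v      ≡⟨ xy∙z≈xz∙y a₁ b (l * v) ⟩
      a₁ + l * v + b      ≈⟨ +-congʳ b a₁+lv≈x ⟩
      x + b               ≈⟨ x+b≈y ⟩
      y                   ∎

Grid : (n r s t : ℕ) → Point → Set
Grid n r s t (x , y) = (t ≤ x × x ≤ t + r ∸ 1) × ((∃[ k ] (k ≤ s × y ≡ k * r)) ⊎ y ≡ n ∸ 1)

module GridDifferences (n r s t : ℕ) .{{_ : NonZero n}} .{{_ : NonZero r}}
  (t+r≤n : t + r ≤ n) (s*r<n : s * r < n) (n∸2<[1+s]*r : n ∸ 2 < suc s * r) where

  open Modular n
  open import Relation.Binary.Reasoning.Setoid ≈-setoid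

  GridPointWith : (ℕ → ℕ → Set) → Set
  GridPointWith P = ∃[ x ] ∃[ y ] (x < n × y < n × Grid n r s t (x , y) × P x y)

  private
    last-column : t + r ∸ 1 ≡ t + pred r
    last-column = +-∸-assoc t (>-nonZero⁻¹ r)

    last-column<n : t + pred r < n
    last-column<n = ≤-trans (≤-reflexive (trans (sym (+-suc t (pred r))) (cong (t +_) (suc-pred r)))) t+r≤n

  grid-hits-zero : GridPointWith (λ x y → x + 0 ≈ y + (t + r))
  grid-hits-zero = t + pred r , pred n , last-column<n , ≤-reflexive (suc-pred n) ,
    ((m≤m+n t (pred r) , ≤-reflexive (sym last-column)) , inj₂ refl) , (begin
      t + pred r + 0                         ≡⟨ +-identityʳ (t + pred r) ⟩
      t + pred r                             ≈⟨ m+n≈m (t + pred r) ⟨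
      t + pred r + n                         ≡⟨ corner ⟩
      pred n + (t + r)                       ∎)
    where
    shift : ∀ t a k → t + a + suc k ≡ k + (t + suc a)
    shift = solve-∀
    corner : t + pred r + n ≡ pred n + (t + r)
    corner = subst₂ (λ n′ r′ → t + pred r + n′ ≡ pred n + (t + r′))
                    (suc-pred n) (suc-pred r) (shift t (pred r) (pred n))

  grid-hits-suc : ∀ {u} → suc u < n → GridPointWith (λ x y → x + suc u ≈ y + (t + r))
  grid-hits-suc {u} u+1<n = t + (pred r ∸ j) , k * r , x<n , y<n ,
    ((m≤m+n t (pred r ∸ j) , ≤-trans x≤t+pred[r] (≤-reflexive (sym last-column))) , inj₁ (k , k≤s , refl)) ,
    u+1-hit
    where
    j = u % r
    k = u / r
    j≤pred[r] : j ≤ pred r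
    j≤pred[r] = <⇒≤pred (m%n<n u r)
    x≤t+pred[r] : t + (pred r ∸ j) ≤ t + pred r
    x≤t+pred[r] = +-monoʳ-≤ t (m∸n≤m (pred r) j)
    x<n : t + (pred r ∸ j) < n
    x<n = ≤-<-trans x≤t+pred[r] last-column<n
    k≤s : k ≤ s
    k≤s = s≤s⁻¹ (m<n*o⇒m/o<n (≤-<-trans (∸-monoˡ-≤ 2 u+1<n) n∸2<[1+s]*r))
    y<n : k * r < n
    y<n = ≤-<-trans (*-monoˡ-≤ r k≤s) s*r<n
    rearrange : ∀ t e j kr → t + e + suc (j + kr) ≡ kr + (t + suc (e + j))
    rearrange = solve-∀
    u+1-hit : t + (pred r ∸ j) + suc u ≈ k * r + (t + r)
    u+1-hit = begin
      t + (pred r ∸ j) + suc u                ≡⟨ cong (λ w → t + (pred r ∸ j) + suc w) (m≡m%n+[m/n]*n u r) ⟩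
      t + (pred r ∸ j) + suc (j + k * r)      ≡⟨ rearrange t (pred r ∸ j) j (k * r) ⟩
      k * r + (t + suc (pred r ∸ j + j))      ≡⟨ cong (λ w → k * r + (t + suc w)) (m∸n+n≡m j≤pred[r]) ⟩
      k * r + (t + suc (pred r))              ≡⟨ cong (λ w → k * r + (t + w)) (suc-pred r) ⟩
      k * r + (t + r)                         ∎

  grid-hits : ∀ m → m < n → GridPointWith (λ x y → x + m ≈ y + (t + r))
  grid-hits zero    _     = grid-hits-zero
  grid-hits (suc u) u+1<n = grid-hits-suc u+1<n

  grid-differences : ∀ b → GridPointWith (λ x y → x + b ≈ y)
  grid-differences b with grid-hits ((b + (t + r)) % n) (m%n<n (b + (t + r)) n)
  ... | x , y , x<n , y<n , x,y∈grid , hit = x , y , x<n , y<n , x,y∈grid ,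
    +-cancelʳ-≈ (t + r) (begin
      x + b + (t + r)               ≡⟨ +-assoc x b (t + r) ⟩
      x + (b + (t + r))             ≈⟨ +-congˡ x (m%n≈m (b + (t + r))) ⟨
      x + (b + (t + r)) % n         ≈⟨ hit ⟩
      y + (t + r)                   ∎)

lemma2p2 : (p r s t : ℕ) → (pr : Prime p) → 3 ≤ p →
    r * r ≤ p → p < suc r * suc r →
    s * r ≤ p ∸ 2 → p ∸ 2 < suc s * r →
    t ≤ p ∸ r →
    IsBlocking p {{prime⇒nonZero pr}} (DiagGrid p r s t)
lemma2p2 _ zero _ _ _ () _ (s≤s z≤n) _ _ _
lemma2p2 p r@(suc _) s t pr 3≤p r*r≤p _ s*r≤p∸2 p∸2<[1+s]*r t≤p∸r = blocks
  where
  instance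
    p≢0 : NonZero p
    p≢0 = prime⇒nonZero pr
  open Modular p
  open PrimeField p pr

  t+r≤p : t + r ≤ p
  t+r≤p = ≤-trans (+-monoˡ-≤ r t≤p∸r) (≤-reflexive (m∸n+n≡m (≤-trans (m≤m*n r r) r*r≤p)))

  s*r<p : s * r < p
  s*r<p = ≤-<-trans s*r≤p∸2 (∸-monoʳ-< (s≤s z≤n) (≤-trans (s≤s (s≤s z≤n)) 3≤p))

  open GridDifferences p r s t t+r≤p s*r<p p∸2<[1+s]*r

  blocks : IsBlocking p (DiagGrid p r s t)
  blocks a₁ a₂ v₁ v₂ _ _ v₁<p v₂<p v≢0 with v₁ ≟ v₂
  ... | no v₁≢v₂ =
    let l , l<p , on-diagonal = line-meets-diagonal v₁≢v₂ v₁<p v₂<p a₁ a₂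
    in  l , l<p , inj₁ on-diagonal
  ... | yes refl =
    let 0<v₁ = n≢0⇒n>0 (λ v₁≡0 → v≢0 (v₁≡0 , v₁≡0))
        b , a₁+b≈a₂ = +-solvable a₁ a₂
        x , y , x<p , y<p , x,y∈grid , x+b≈y = grid-differences b
        l , l<p , line-hits-x,y = slope-one-line-through 0<v₁ v₁<p a₁+b≈a₂ x+b≈y x<p y<p
    in  l , l<p , subst (DiagGrid p r s t) (sym line-hits-x,y) (inj₂ x,y∈grid)
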